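{- $\sum_{i\in S}\pi(i)\le\frac1\theta$.
   Context: $S$ is a finite state space partitioned into levels $S_0=\{r\},S_1,\dots,S_{L-1}$ and forming a rooted tree with root $r$. Each $i\in S_\ell$ with $\ell>0$ has a unique parent $\mathrm{pa}(i)\in S_{\ell-1}$, and $\mathrm{child}(i)=\{k:\mathrm{pa}(k)=i\}$. There are transition probabilities $P(\mathrm{pa}(i),i)>0$ with $\sum_{k\in\mathrm{child}(i)}P(i,k)\le1$. Let $\theta=\min_{i\in S}\bigl(1-\sum_{k\in\mathrm{child}(i)}P(i,k)\bigr)$, assumed to satisfy $\theta>0$. Let $\mathrm{anc}(i)$ be the set of states on the path from $r$ to $i$, inclusive. Let $\pi(r)=1$ and $\pi(i)=\prod_{k\in\mathrm{anc}(i)\setminus\{r\}}P(\mathrm{pa}(k),k)$.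
   Formalization: The transition probabilities are rational, so $\theta$ and the weights $\pi(i)$ are rational as well. -}

module Defs where

open import Data.Nat using (ℕ; zero; suc)
open import Data.Fin using (Fin; zero; suc; _≟_)
open import Data.Rational using (ℚ; 0ℚ; 1ℚ; _+_; _*_; _-_; _⊓_)
open import Relation.Nullary using (yes; no)

sumF : ∀ {n} → (Fin n → ℚ) → ℚ
sumF {zero}  f = 0ℚ
sumF {suc n} f = f zero + sumF (λ k → f (suc k))

minF : ∀ {n} → (Fin (suc n) → ℚ) → ℚ
minF {zero}  f = f zero
minF {suc n} f = f zero ⊓ minF (λ k → f (suc k))

-- The state space is S = Fin (suc m), root r, parent map pa (its value at r
-- is irrelevant), transition probabilities P.

-- Contribution P(i,k) if k ∈ child(i) (i.e. k ≠ r and pa k = i), else 0.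
childTerm : ∀ {m} (r : Fin (suc m)) (pa : Fin (suc m) → Fin (suc m))
            (P : Fin (suc m) → Fin (suc m) → ℚ) → Fin (suc m) → Fin (suc m) → ℚ
childTerm r pa P i k with k ≟ r
... | yes _ = 0ℚ
... | no _ with pa k ≟ i
...   | yes _ = P i k
...   | no _  = 0ℚ

childSum : ∀ {m} (r : Fin (suc m)) (pa : Fin (suc m) → Fin (suc m))
           (P : Fin (suc m) → Fin (suc m) → ℚ) → Fin (suc m) → ℚ
childSum r pa P i = sumF (childTerm r pa P i)

theta : ∀ {m} (r : Fin (suc m)) (pa : Fin (suc m) → Fin (suc m))
        (P : Fin (suc m) → Fin (suc m) → ℚ) → ℚ
theta r pa P = minF (λ i → 1ℚ - childSum r pa P i)

piAux : ∀ {m} (r : Fin (suc m)) (pa : Fin (suc m) → Fin (suc m))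
        (P : Fin (suc m) → Fin (suc m) → ℚ) → ℕ → Fin (suc m) → ℚ
piAux r pa P zero    i = 1ℚ
piAux r pa P (suc d) i with i ≟ r
... | yes _ = 1ℚ
... | no _  = P (pa i) i * piAux r pa P d (pa i)

-- π(i) = ∏_{k ∈ anc(i) \ {r}} P(pa k, k); the path from i to r has exactly
-- lvl i edges, so walking lvl i steps traverses anc(i) exactly.
piW : ∀ {m} (r : Fin (suc m)) (pa : Fin (suc m) → Fin (suc m))
      (P : Fin (suc m) → Fin (suc m) → ℚ) (lvl : Fin (suc m) → ℕ) →
      Fin (suc m) → ℚ
piW r pa P lvl i = piAux r pa P (lvl i) i

{-# OPTIONS --safe #-}
-- π is a flow on the tree: each non-root state k receives π(pa k) P(pa k, k) = π(k)
-- from its parent and the root receives nothing.  So the total outflow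
-- Σᵢ π(i) Σ_{k ∈ child(i)} P(i,k) equals Σ_{k ≠ r} π(k) = Σ π − 1, that is
-- Σᵢ π(i) (1 − Σ_{k ∈ child(i)} P(i,k)) = 1, and each factor 1 − Σ_k P(i,k) is at least θ.
module Submission where

open import Defs
open import Algebra.Bundles using (CommutativeRing)
open import Data.Nat using (ℕ; suc; zero)
open import Data.Fin using (Fin; zero; suc; _≟_; punchIn)
open import Data.Fin.Properties using (punchInᵢ≢i)
open import Data.Rational
  using (ℚ; 0ℚ; 1ℚ; _≤_; _<_; 1/_; _+_; _*_; _-_; positive; Positive; nonNegative)
open import Data.Rational.Properties
  using ( +-*-commutativeRing; +-identityˡ; +-identityʳ; *-comm; *-zeroʳ; *-inverseʳ; ≤-refl; ≤-trans
        ; ≤-reflexive; <⇒≤; +-mono-≤; p⊓q≤p; p⊓q≤q; *-cancelˡ-≤-pos; *-monoˡ-≤-nonNeg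
        ; pos⇒nonZero; nonNegative⁻¹; nonNeg*nonNeg⇒nonNeg; module ≤-Reasoning)
open import Data.Rational.Solver using (module +-*-Solver)
open import Algebra.Properties.Semiring.Sum (CommutativeRing.semiring +-*-commutativeRing)
  using (sum; sum-cong-≗; sum-replicate-zero; sum-remove; ∑-comm; *-distribˡ-sum)
open import Function using (_∘_; _⇔_; Equivalence)
open import Relation.Binary.PropositionalEquality
  using (_≡_; _≢_; refl; sym; trans; cong; cong₂; module ≡-Reasoning)
open import Relation.Nullary using (yes; no; contradiction)

open +-*-Solver

sumF≡sum : ∀ {n} (f : Fin n → ℚ) → sumF f ≡ sum f
sumF≡sum {zero}  f = refl
sumF≡sum {suc n} f = cong (f zero +_) (sumF≡sum (f ∘ suc))

sum-zero : ∀ {n} {f : Fin n → ℚ} → (∀ i → f i ≡ 0ℚ) → sum f ≡ 0ℚ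
sum-zero {n} f≡0 = trans (sum-cong-≗ f≡0) (sum-replicate-zero n)

sum-supported : ∀ {n} (f : Fin (suc n) → ℚ) j → (∀ i → i ≢ j → f i ≡ 0ℚ) → sum f ≡ f j
sum-supported f j f≡0 = begin
  sum f                                 ≡⟨ sum-remove f ⟩
  f j + sum (λ k → f (punchIn j k))     ≡⟨ cong (f j +_) (sum-zero (λ k → f≡0 _ (punchInᵢ≢i j k))) ⟩
  f j + 0ℚ                              ≡⟨ +-identityʳ (f j) ⟩
  f j                                   ∎
  where open ≡-Reasoning

∑-distrib-sub : ∀ {n} (f g : Fin n → ℚ) → sum (λ i → f i - g i) ≡ sum f - sum g
∑-distrib-sub {zero}  f g = refl
∑-distrib-sub {suc n} f g = trans (cong (f zero - g zero +_) (∑-distrib-sub (f ∘ suc) (g ∘ suc)))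
  (solve 4 (λ a b c d → (a :- b) :+ (c :- d) := (a :+ c) :- (b :+ d)) refl
     (f zero) (g zero) (sum (f ∘ suc)) (sum (g ∘ suc)))

sum-mono-≤ : ∀ {n} {f g : Fin n → ℚ} → (∀ i → f i ≤ g i) → sum f ≤ sum g
sum-mono-≤ {zero}  f≤g = ≤-refl
sum-mono-≤ {suc n} f≤g = +-mono-≤ (f≤g zero) (sum-mono-≤ (f≤g ∘ suc))

minF≤ : ∀ {n} (f : Fin (suc n) → ℚ) i → minF f ≤ f i
minF≤ {zero}  f zero    = ≤-refl
minF≤ {suc n} f zero    = p⊓q≤p (f zero) _
minF≤ {suc n} f (suc i) = ≤-trans (p⊓q≤q (f zero) _) (minF≤ (f ∘ suc) i)

*≤1⇒≤1/ : ∀ p .{{_ : Positive p}} q → p * q ≤ 1ℚ → q ≤ (1/ p) {{pos⇒nonZero p}}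
*≤1⇒≤1/ p q pq≤1 = *-cancelˡ-≤-pos p (≤-trans pq≤1 (≤-reflexive (sym (*-inverseʳ p {{pos⇒nonZero p}}))))

module Tree {m} (r : Fin (suc m)) (pa : Fin (suc m) → Fin (suc m))
            (P : Fin (suc m) → Fin (suc m) → ℚ) where

  childTerm-root : ∀ i → childTerm r pa P i r ≡ 0ℚ
  childTerm-root i with r ≟ r
  ... | yes _   = refl
  ... | no r≢r = contradiction refl r≢r

  childTerm-parent : ∀ {k} → k ≢ r → childTerm r pa P (pa k) k ≡ P (pa k) k
  childTerm-parent {k} k≢r with k ≟ r
  ... | yes k≡r = contradiction k≡r k≢r
  ... | no _ with pa k ≟ pa k
  ...   | yes _ = refl
  ...   | no ≢  = contradiction refl ≢

  childTerm-nonparent : ∀ {i k} → k ≢ r → i ≢ pa k → childTerm r pa P i k ≡ 0ℚ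
  childTerm-nonparent {i} {k} k≢r i≢pa with k ≟ r
  ... | yes k≡r = contradiction k≡r k≢r
  ... | no _ with pa k ≟ i
  ...   | yes pa≡i = contradiction (sym pa≡i) i≢pa
  ...   | no _     = refl

  piAux-step : ∀ d {k} → k ≢ r → piAux r pa P (suc d) k ≡ P (pa k) k * piAux r pa P d (pa k)
  piAux-step d {k} k≢r with k ≟ r
  ... | yes k≡r = contradiction k≡r k≢r
  ... | no _    = refl

  piAux-nonNeg : (∀ i → i ≢ r → 0ℚ ≤ P (pa i) i) → ∀ d i → 0ℚ ≤ piAux r pa P d i
  piAux-nonNeg P≥0 zero    i = nonNegative⁻¹ 1ℚ
  piAux-nonNeg P≥0 (suc d) i with i ≟ r
  ... | yes _   = nonNegative⁻¹ 1ℚ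
  ... | no i≢r = nonNegative⁻¹ (p * q) {{nonNeg*nonNeg⇒nonNeg p {{nonNegative (P≥0 i i≢r)}}
                                                                q {{nonNegative (piAux-nonNeg P≥0 d (pa i))}}}}
    where
    p = P (pa i) i
    q = piAux r pa P d (pa i)

  module Levels (lvl : Fin (suc m) → ℕ) (lvl-root : lvl r ≡ 0)
                (lvl-pa : ∀ i → i ≢ r → suc (lvl (pa i)) ≡ lvl i) where

    π : Fin (suc m) → ℚ
    π = piW r pa P lvl

    inflow outflow : Fin (suc m) → ℚ
    inflow k  = sum (λ i → π i * childTerm r pa P i k)
    outflow i = π i * childSum r pa P i

    π-nonNeg : (∀ i → i ≢ r → 0ℚ ≤ P (pa i) i) → ∀ i → 0ℚ ≤ π i
    π-nonNeg P≥0 i = piAux-nonNeg P≥0 (lvl i) i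

    π-root : π r ≡ 1ℚ
    π-root = cong (λ d → piAux r pa P d r) lvl-root

    π-child : ∀ {k} → k ≢ r → π k ≡ π (pa k) * P (pa k) k
    π-child {k} k≢r = begin
      piAux r pa P (lvl k) k                       ≡⟨ cong (λ d → piAux r pa P d k) (lvl-pa k k≢r) ⟨
      piAux r pa P (suc (lvl (pa k))) k            ≡⟨ piAux-step (lvl (pa k)) k≢r ⟩
      P (pa k) k * π (pa k)                        ≡⟨ *-comm (P (pa k) k) (π (pa k)) ⟩
      π (pa k) * P (pa k) k                        ∎
      where open ≡-Reasoning

    inflow-root : inflow r ≡ 0ℚ
    inflow-root = sum-zero (λ i → trans (cong (π i *_) (childTerm-root i)) (*-zeroʳ (π i)))

    inflow-child : ∀ {k} → k ≢ r → inflow k ≡ π k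
    inflow-child {k} k≢r = begin
      inflow k                                     ≡⟨ sum-supported _ (pa k) only-parent ⟩
      π (pa k) * childTerm r pa P (pa k) k         ≡⟨ cong (π (pa k) *_) (childTerm-parent k≢r) ⟩
      π (pa k) * P (pa k) k                        ≡⟨ π-child k≢r ⟨
      π k                                          ∎
      where
      open ≡-Reasoning
      only-parent : ∀ i → i ≢ pa k → π i * childTerm r pa P i k ≡ 0ℚ
      only-parent i i≢pa = trans (cong (π i *_) (childTerm-nonparent k≢r i≢pa)) (*-zeroʳ (π i))

    sum-outflow≡sum-inflow : sum outflow ≡ sum inflow
    sum-outflow≡sum-inflow = begin
      sum (λ i → π i * sumF (ct i))                ≡⟨ sum-cong-≗ (λ i → cong (π i *_) (sumF≡sum (ct i))) ⟩
      sum (λ i → π i * sum (ct i))                 ≡⟨ sum-cong-≗ (λ i → *-distribˡ-sum (π i) (ct i)) ⟩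
      sum (λ i → sum (λ k → π i * ct i k))         ≡⟨ ∑-comm (λ i k → π i * ct i k) ⟩
      sum inflow                                   ∎
      where
      open ≡-Reasoning
      ct = childTerm r pa P

    sum-inflow≡sum-π-nonroot : sum inflow ≡ sum (π ∘ punchIn r)
    sum-inflow≡sum-π-nonroot = begin
      sum inflow                                   ≡⟨ sum-remove {i = r} inflow ⟩
      inflow r + sum (inflow ∘ punchIn r)          ≡⟨ cong (_+ sum (inflow ∘ punchIn r)) inflow-root ⟩
      0ℚ + sum (inflow ∘ punchIn r)                ≡⟨ +-identityˡ (sum (inflow ∘ punchIn r)) ⟩
      sum (inflow ∘ punchIn r)                     ≡⟨ sum-cong-≗ (λ k → inflow-child (punchInᵢ≢i r k)) ⟩
      sum (π ∘ punchIn r)                          ∎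
      where open ≡-Reasoning

    sum-π≡1+sum-outflow : sum π ≡ 1ℚ + sum outflow
    sum-π≡1+sum-outflow = begin
      sum π                                        ≡⟨ sum-remove {i = r} π ⟩
      π r + sum (π ∘ punchIn r)                    ≡⟨ cong₂ _+_ π-root (sym sum-inflow≡sum-π-nonroot) ⟩
      1ℚ + sum inflow                              ≡⟨ cong (1ℚ +_) sum-outflow≡sum-inflow ⟨
      1ℚ + sum outflow                             ∎
      where open ≡-Reasoning

    sum-π[1-childSum]≡1 : sum (λ i → π i * (1ℚ - childSum r pa P i)) ≡ 1ℚ
    sum-π[1-childSum]≡1 = begin
      sum (λ i → π i * (1ℚ - childSum r pa P i))   ≡⟨ sum-cong-≗ (λ i → distrib (π i) (childSum r pa P i)) ⟩
      sum (λ i → π i - outflow i)                  ≡⟨ ∑-distrib-sub π outflow ⟩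
      sum π - sum outflow                          ≡⟨ cong (_- sum outflow) sum-π≡1+sum-outflow ⟩
      1ℚ + sum outflow - sum outflow               ≡⟨ solve 1 (λ x → con 1ℚ :+ x :- x := con 1ℚ) refl (sum outflow) ⟩
      1ℚ                                           ∎
      where
      open ≡-Reasoning
      distrib : ∀ a b → a * (1ℚ - b) ≡ a - a * b
      distrib = solve 2 (λ a b → a :* (con 1ℚ :- b) := a :- a :* b) refl

    theta*sum-π≤1 : (∀ i → i ≢ r → 0ℚ ≤ P (pa i) i) → theta r pa P * sum π ≤ 1ℚ
    theta*sum-π≤1 P≥0 = begin
      θ * sum π                                    ≡⟨ *-distribˡ-sum θ π ⟩
      sum (λ i → θ * π i)                          ≤⟨ sum-mono-≤ θπ≤ ⟩
      sum (λ i → π i * (1ℚ - childSum r pa P i))   ≡⟨ sum-π[1-childSum]≡1 ⟩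
      1ℚ                                           ∎
      where
      open ≤-Reasoning
      θ = theta r pa P
      θπ≤ : ∀ i → θ * π i ≤ π i * (1ℚ - childSum r pa P i)
      θπ≤ i = begin
        θ * π i                                    ≡⟨ *-comm θ (π i) ⟩
        π i * θ                                    ≤⟨ *-monoˡ-≤-nonNeg (π i) {{nonNegative (π-nonNeg P≥0 i)}}
                                                        (minF≤ (λ j → 1ℚ - childSum r pa P j) i) ⟩
        π i * (1ℚ - childSum r pa P i)             ∎

lemma21 : (m : ℕ) (r : Fin (suc m)) (pa : Fin (suc m) → Fin (suc m))
          (lvl : Fin (suc m) → ℕ) (P : Fin (suc m) → Fin (suc m) → ℚ) →
          (∀ i → (lvl i ≡ 0) ⇔ (i ≡ r)) →
          (∀ i → i ≢ r → suc (lvl (pa i)) ≡ lvl i) →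
          (∀ i → i ≢ r → 0ℚ < P (pa i) i) →
          (∀ i → childSum r pa P i ≤ 1ℚ) →
          (θpos : 0ℚ < theta r pa P) →
          sumF (piW r pa P lvl)
            ≤ (1/ theta r pa P) {{pos⇒nonZero (theta r pa P) {{positive θpos}}}}
lemma21 m r pa lvl P lvl≡0⇔root lvl-pa P>0 _ θ>0 = begin
  sumF π                       ≡⟨ sumF≡sum π ⟩
  sum π                        ≤⟨ *≤1⇒≤1/ θ {{positive θ>0}} (sum π) (theta*sum-π≤1 (λ i → <⇒≤ ∘ P>0 i)) ⟩
  (1/ θ) {{pos⇒nonZero θ {{positive θ>0}}}} ∎
  where
  open ≤-Reasoning
  open Tree r pa P
  open Levels lvl (Equivalence.from (lvl≡0⇔root r) refl) lvl-pa
  θ = theta r pa P
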